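{- Let $\alpha(k)$ be the largest odd divisor of $k$ and $V(n)=\sum_{k=1}^n\frac{\alpha(k)}{k}$. For every positive integer $n$, $$\frac{2n^2+1}{3n}\le V(n)\le\frac{2n(n+2)}{3(n+1)}.$$ Moreover, the lower bound is attained if and only if $n=2^m$ for some nonnegative integer $m$, and the upper bound is attained if and only if $n=2^{m+1}-1$ for some nonnegative integer $m$.
   Context: $\alpha(k)$ is the largest odd divisor of the positive integer $k$. -}

module Defs where

open import Data.Nat using (ℕ; zero; suc; _⊔_)
open import Data.Nat.Divisibility using (_∣_; _∣?_)
open import Data.List using (List; foldr; filter; upTo; map)
open import Data.Product using (_×_)
open import Relation.Nullary using (¬_)
open import Relation.Nullary.Decidable using (_×-dec_; ¬?)
open import Data.Integer using (+_)
open import Data.Rational using (ℚ; _/_; _+_; 0ℚ)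

OddDivisor : ℕ → ℕ → Set
OddDivisor k d = (d ∣ k) × ¬ (2 ∣ d)

-- α k = the largest odd divisor of k : the maximum of all odd divisors d
-- of k with 1 ≤ d ≤ k (for k ≥ 1 every divisor lies in this range).
α : ℕ → ℕ
α k = foldr _⊔_ 0 (filter (λ d → (d ∣? k) ×-dec ¬? (2 ∣? d)) (map suc (upTo k)))

V : ℕ → ℚ
V zero    = 0ℚ
V (suc n) = V n + (+ α (suc n)) / suc n

open import Data.Nat using (NonZero) renaming (_+_ to _+ℕ_; _*_ to _*ℕ_)
open import Data.Nat.Properties using (m*n≢0)

lowerBound : (n : ℕ) → .{{NonZero n}} → ℚ
lowerBound n = _/_ (+ (2 *ℕ n *ℕ n +ℕ 1)) (3 *ℕ n) {{m*n≢0 3 n}}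

upperBound : ℕ → ℚ
upperBound n = (+ (2 *ℕ n *ℕ (n +ℕ 2))) / (3 *ℕ suc n)

{-# OPTIONS --safe #-}
module Submission where

open import Defs
open import Data.Nat using (ℕ; suc; NonZero; _^_; _∸_)
open import Data.Product using (_×_; ∃-syntax; _,_; proj₁; proj₂)
open import Data.Rational using (ℚ; _≤_)
open import Relation.Binary.PropositionalEquality using (_≡_)
open import Function.Bundles using (_⇔_; mk⇔)

open import Data.Nat as ℕ using (zero; _⊔_; z≤n; s≤s; ≢-nonZero⁻¹)
  renaming (_+_ to _+ℕ_; _*_ to _*ℕ_)
import Data.Nat.Properties as ℕ
open import Data.Nat.Divisibility
  using (_∣_; _∣?_; ∣⇒≤; ∣-refl; ∣n⇒∣m*n; m∣m*n; 0∣⇒≡0; ∣1⇒≡1; ∣m+n∣m⇒∣n)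
open import Data.Nat.Coprimality using (Coprime; coprime-divisor)
open import Data.Nat.Induction using (<-rec)
open import Data.Nat.Primality using (irreducible[2])
open import Data.List using (List; foldr; filter; upTo; map)
open import Data.List.Membership.Propositional using (_∈_)
open import Data.List.Membership.Propositional.Properties
  using (∈-filter⁺; ∈-filter⁻; ∈-map⁺; ∈-upTo⁺)
open import Data.List.Properties using (foldr-preservesᵇ; foldr-preservesᵒ)
open import Data.List.Relation.Unary.All using (tabulate)
import Data.List.Relation.Unary.Any as Any
open import Data.Sum as Sum using (_⊎_; inj₁; inj₂; [_,_])
open import Function.Base using (_∘_)
open import Relation.Nullary using (Dec; ¬_; contradiction)
open import Relation.Nullary.Decidable using (_×-dec_; ¬?)
open import Relation.Binary.PropositionalEquality
  using (refl; sym; trans; cong; cong₂; subst; subst₂; module ≡-Reasoning)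
open import Data.Integer as ℤ using (+_)
import Data.Integer.Properties as ℤ
open import Data.Rational
  using (_<_; _+_; _*_; _-_; _/_; 0ℚ; 1ℚ; ½; toℚᵘ; Positive; positive; nonNegative)
open import Data.Rational.Literals using (fromℤ)
open import Data.Rational.Properties as ℚ
  using (toℚᵘ-injective; toℚᵘ-fromℚᵘ; toℚᵘ-homo-+; toℚᵘ-homo-*; fromℚᵘ-cong; positive⁻¹; nonNegative⁻¹)
open import Data.Rational.Unnormalised as ℚᵘ using (mkℚᵘ; *≡*)
import Data.Rational.Unnormalised.Properties as ℚᵘ
open import Data.Rational.Solver using (module +-*-Solver)
open +-*-Solver using (solve; _:=_; _:+_; _:*_; _:-_; con)

-- Put E(n) = 3 V(n) - 2n. Since α(2m) = α(m) and α(2m+1) = 2m+1, we get V(2m) = m + V(m)/2 and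
-- V(2m+1) = V(2m) + 1, hence E(2m) = E(m)/2 and E(2m+1) = E(m)/2 + 1: E(n) = Σ bᵢ 2⁻ⁱ for the
-- binary digits bᵢ of n, so 0 ≤ E ≤ 2. The two bounds say that the defects n E(n) - 1 and
-- 2n - (n+1) E(n) are nonnegative. The lower defect is invariant under n ↦ 2n and becomes positive
-- under n ↦ 2n+1 (n ≥ 1); the upper defect is invariant under n ↦ 2n+1 and becomes positive under
-- n ↦ 2n. Both vanish at n = 1, so binary induction shows that each defect vanishes exactly on the
-- orbit of 1 under its invariance, i.e. at n = 2^m, resp. n = 2^(m+1) - 1, and is positive elsewhere.

≤-foldr-⊔ : ∀ {x xs} → x ∈ xs → x ℕ.≤ foldr _⊔_ 0 xs
≤-foldr-⊔ {xs = xs} x∈xs = foldr-preservesᵒ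
  (λ a b → [ ℕ.m≤n⇒m≤n⊔o b , ℕ.m≤n⇒m≤o⊔n a ]) 0 xs (inj₂ (Any.map ℕ.≤-reflexive x∈xs))

foldr-⊔-≤ : ∀ {m xs} → (∀ {x} → x ∈ xs → x ℕ.≤ m) → foldr _⊔_ 0 xs ℕ.≤ m
foldr-⊔-≤ bound = foldr-preservesᵇ ℕ.⊔-lub z≤n (tabulate bound)

oddDivisor? : ∀ k d → Dec (OddDivisor k d)
oddDivisor? k d = (d ∣? k) ×-dec ¬? (2 ∣? d)

oddDivisors : ℕ → List ℕ
oddDivisors k = filter (oddDivisor? k) (map suc (upTo k))

∈-oddDivisors⁺ : ∀ {k d} .{{_ : NonZero k}} → OddDivisor k d → d ∈ oddDivisors k
∈-oddDivisors⁺ {k} {zero} (0∣k , _) = contradiction (0∣⇒≡0 0∣k) (≢-nonZero⁻¹ k)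
∈-oddDivisors⁺ {k} {suc _} odd@(d∣k , _) =
  ∈-filter⁺ (oddDivisor? k) (∈-map⁺ suc (∈-upTo⁺ (∣⇒≤ d∣k))) odd

∈-oddDivisors⁻ : ∀ {k d} → d ∈ oddDivisors k → OddDivisor k d
∈-oddDivisors⁻ {k} = proj₂ ∘ ∈-filter⁻ (oddDivisor? k) {xs = map suc (upTo k)}

oddDivisor⇒≤α : ∀ {k d} .{{_ : NonZero k}} → OddDivisor k d → d ℕ.≤ α k
oddDivisor⇒≤α odd = ≤-foldr-⊔ (∈-oddDivisors⁺ odd)

α-least : ∀ {k m} → (∀ {d} → OddDivisor k d → d ℕ.≤ m) → α k ℕ.≤ m
α-least bound = foldr-⊔-≤ (bound ∘ ∈-oddDivisors⁻)

α-odd : ∀ {k} .{{_ : NonZero k}} → ¬ 2 ∣ k → α k ≡ k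
α-odd 2∤k = ℕ.≤-antisym (α-least (λ (d∣k , _) → ∣⇒≤ d∣k)) (oddDivisor⇒≤α (∣-refl , 2∤k))

odd⇒coprime[2] : ∀ {d} → ¬ 2 ∣ d → Coprime d 2
odd⇒coprime[2] 2∤d (i∣d , i∣2) with irreducible[2] i∣2
... | inj₁ i≡1 = i≡1
... | inj₂ refl = contradiction i∣d 2∤d

α-double : ∀ k .{{_ : NonZero k}} → α (2 *ℕ k) ≡ α k
α-double k = ℕ.≤-antisym
  (α-least {2 *ℕ k} (λ (d∣2k , 2∤d) →
    oddDivisor⇒≤α (coprime-divisor (odd⇒coprime[2] 2∤d) d∣2k , 2∤d)))
  (α-least {k} (λ (d∣k , 2∤d) → oddDivisor⇒≤α {{ℕ.m*n≢0 2 k}} (∣n⇒∣m*n 2 d∣k , 2∤d)))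

2∤1+2*m : ∀ m → ¬ 2 ∣ suc (2 *ℕ m)
2∤1+2*m m 2∣1+2m = contradiction (∣1⇒≡1 2∣1) λ ()
  where
  2∣1 : 2 ∣ 1
  2∣1 = ∣m+n∣m⇒∣n (subst (2 ∣_) (ℕ.+-comm 1 (2 *ℕ m)) 2∣1+2m) (m∣m*n m)

data Parity : ℕ → Set where
  even : ∀ m → Parity (2 *ℕ m)
  odd  : ∀ m → Parity (suc (2 *ℕ m))

parity : ∀ n → Parity n
parity zero = even 0
parity (suc n) with parity n
... | even m = odd m
... | odd m = subst Parity (ℕ.*-suc 2 m) (even (suc m))

positive-binary-induction : (P : ℕ → Set) → P 1 →
  (∀ m .{{_ : NonZero m}} → P m → P (2 *ℕ m)) →
  (∀ m .{{_ : NonZero m}} → P m → P (suc (2 *ℕ m))) →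
  ∀ n .{{_ : NonZero n}} → P n
positive-binary-induction P P1 P-even P-odd n = <-rec Q step n
  where
  Q : ℕ → Set
  Q n = .{{_ : NonZero n}} → P n
  by-parity : ∀ {n} → Parity n → (∀ {k} → k ℕ.< n → Q k) → Q n
  by-parity (even zero) rec {{()}}
  by-parity (even (suc m)) rec = P-even (suc m) (rec (s≤s (ℕ.m<m+n m ℕ.z<s)))
  by-parity (odd zero) rec = P1
  by-parity (odd (suc m)) rec = P-odd (suc m) (rec (s≤s (ℕ.m≤n*m (suc m) 2)))
  step : ∀ n → (∀ {k} → k ℕ.< n → Q k) → Q n
  step n = by-parity (parity n)

-- A numeral rather than + n / 1, so that toℚᵘ (fromℕ n) is mkℚᵘ (+ n) 0 definitionally.
fromℕ : ℕ → ℚ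
fromℕ n = fromℤ (+ n)

2ℚ 3ℚ : ℚ
2ℚ = fromℕ 2
3ℚ = fromℕ 3

fromℕ-+ : ∀ m n → fromℕ (m +ℕ n) ≡ fromℕ m + fromℕ n
fromℕ-+ m n = toℚᵘ-injective
  (ℚᵘ.≃-trans (*≡* eq) (ℚᵘ.≃-sym (toℚᵘ-homo-+ (fromℕ m) (fromℕ n))))
  where
  eq : + (m +ℕ n) ℤ.* + 1 ≡ (+ m ℤ.* + 1 ℤ.+ + n ℤ.* + 1) ℤ.* + 1
  eq = cong (ℤ._* + 1) (trans (ℤ.pos-+ m n)
         (sym (cong₂ ℤ._+_ (ℤ.*-identityʳ (+ m)) (ℤ.*-identityʳ (+ n)))))

fromℕ-* : ∀ m n → fromℕ (m *ℕ n) ≡ fromℕ m * fromℕ n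
fromℕ-* m n = toℚᵘ-injective
  (ℚᵘ.≃-trans (*≡* (cong (ℤ._* + 1) (ℤ.pos-* m n))) (ℚᵘ.≃-sym (toℚᵘ-homo-* (fromℕ m) (fromℕ n))))

fromℕ-suc : ∀ n → fromℕ (suc n) ≡ 1ℚ + fromℕ n
fromℕ-suc = fromℕ-+ 1

fromℕ-double : ∀ n → fromℕ (2 *ℕ n) ≡ 2ℚ * fromℕ n
fromℕ-double = fromℕ-* 2

fromℕ-suc-double : ∀ m → fromℕ (suc (2 *ℕ m)) ≡ 1ℚ + 2ℚ * fromℕ m
fromℕ-suc-double m = trans (fromℕ-suc (2 *ℕ m)) (cong (λ x → 1ℚ + x) (fromℕ-double m))

fromℕ-nonNeg : ∀ n → 0ℚ ≤ fromℕ n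
fromℕ-nonNeg n = nonNegative⁻¹ (fromℕ n)

fromℕ-pos : ∀ n .{{_ : NonZero n}} → 0ℚ < fromℕ n
fromℕ-pos (suc n) = positive⁻¹ (fromℕ (suc n))

fromℕ-*-/ : ∀ a c .{{_ : NonZero c}} → fromℕ c * (+ a / c) ≡ fromℕ a
fromℕ-*-/ a c@(suc c-1) = toℚᵘ-injective (ℚᵘ.≃-trans (toℚᵘ-homo-* (fromℕ c) (+ a / c))
  (ℚᵘ.≃-trans (ℚᵘ.*-congˡ {mkℚᵘ (+ c) 0} (toℚᵘ-fromℚᵘ (mkℚᵘ (+ a) c-1))) (*≡* eq)))
  where
  eq : (+ c ℤ.* + a) ℤ.* + 1 ≡ + a ℤ.* + (1 *ℕ c)
  eq = trans (ℤ.*-identityʳ _)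
         (trans (ℤ.*-comm (+ c) (+ a)) (cong (λ x → + a ℤ.* + x) (sym (ℕ.*-identityˡ c))))

½-*-/ : ∀ a c .{{_ : NonZero c}} → ½ * (+ a / c) ≡ (+ a / (2 *ℕ c)) {{ℕ.m*n≢0 2 c}}
½-*-/ a c@(suc c-1) = toℚᵘ-injective (ℚᵘ.≃-trans (toℚᵘ-homo-* ½ (+ a / c))
  (ℚᵘ.≃-trans (ℚᵘ.*-congˡ {toℚᵘ ½} (toℚᵘ-fromℚᵘ (mkℚᵘ (+ a) c-1)))
  (ℚᵘ.≃-trans (*≡* (cong (ℤ._* + (2 *ℕ c)) (ℤ.*-identityˡ (+ a))))
    (ℚᵘ.≃-sym (toℚᵘ-fromℚᵘ (mkℚᵘ (+ a) (ℕ.pred (2 *ℕ c))))))))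

n/n≡1 : ∀ n .{{_ : NonZero n}} → + n / n ≡ 1ℚ
n/n≡1 n@(suc n-1) = fromℚᵘ-cong {mkℚᵘ (+ n) n-1} {mkℚᵘ (+ 1) 0}
  (*≡* (trans (ℤ.*-identityʳ (+ n)) (sym (ℤ.*-identityˡ (+ n)))))

*-nonNeg : ∀ {p q} → 0ℚ ≤ p → 0ℚ ≤ q → 0ℚ ≤ p * q
*-nonNeg {p} {q} 0≤p 0≤q = nonNegative⁻¹ (p * q)
  {{ℚ.nonNeg*nonNeg⇒nonNeg p {{nonNegative 0≤p}} q {{nonNegative 0≤q}}}}

summand : ℕ → ℚ
summand zero = 0ℚ
summand k@(suc _) = + α k / k

summand-odd : ∀ m → summand (suc (2 *ℕ m)) ≡ 1ℚ
summand-odd m rewrite α-odd (2∤1+2*m m) = n/n≡1 (suc (2 *ℕ m))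

summand-double : ∀ k → summand (2 *ℕ k) ≡ ½ * summand k
summand-double zero = refl
summand-double k@(suc _) = begin
  + α (2 *ℕ k) / (2 *ℕ k) ≡⟨ cong (λ a → + a / (2 *ℕ k)) (α-double k) ⟩
  + α k / (2 *ℕ k)        ≡⟨ sym (½-*-/ (α k) k) ⟩
  ½ * (+ α k / k)         ∎
  where open ≡-Reasoning

V-suc-double : ∀ m → V (suc (2 *ℕ m)) ≡ V (2 *ℕ m) + 1ℚ
V-suc-double m = cong (λ s → V (2 *ℕ m) + s) (summand-odd m)

V-double : ∀ m → V (2 *ℕ m) ≡ fromℕ m + ½ * V m
V-double zero = refl
V-double (suc m) = begin
  V (2 *ℕ suc m)
    ≡⟨ cong V (ℕ.*-suc 2 m) ⟩
  V (suc (2 *ℕ m)) + summand (suc (suc (2 *ℕ m)))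
    ≡⟨ cong₂ _+_ (V-suc-double m) (cong summand (sym (ℕ.*-suc 2 m))) ⟩
  V (2 *ℕ m) + 1ℚ + summand (2 *ℕ suc m)
    ≡⟨ cong₂ (λ v s → v + 1ℚ + s) (V-double m) (summand-double (suc m)) ⟩
  fromℕ m + ½ * V m + 1ℚ + ½ * summand (suc m)
    ≡⟨ solve 3 (λ x v s → x :+ con ½ :* v :+ con 1ℚ :+ con ½ :* s := con 1ℚ :+ x :+ con ½ :* (v :+ s))
         refl (fromℕ m) (V m) (summand (suc m)) ⟩
  1ℚ + fromℕ m + ½ * (V m + summand (suc m))
    ≡⟨ cong (_+ ½ * V (suc m)) (sym (fromℕ-suc m)) ⟩
  fromℕ (suc m) + ½ * V (suc m) ∎
  where open ≡-Reasoning

excess : ℕ → ℚ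
excess n = 3ℚ * V n - 2ℚ * fromℕ n

excess-double : ∀ m → excess (2 *ℕ m) ≡ ½ * excess m
excess-double m = begin
  3ℚ * V (2 *ℕ m) - 2ℚ * fromℕ (2 *ℕ m)
    ≡⟨ cong₂ (λ v x → 3ℚ * v - 2ℚ * x) (V-double m) (fromℕ-double m) ⟩
  3ℚ * (fromℕ m + ½ * V m) - 2ℚ * (2ℚ * fromℕ m)
    ≡⟨ solve 2 (λ x v → con 3ℚ :* (x :+ con ½ :* v) :- con 2ℚ :* (con 2ℚ :* x)
                     := con ½ :* (con 3ℚ :* v :- con 2ℚ :* x))
         refl (fromℕ m) (V m) ⟩
  ½ * excess m ∎
  where open ≡-Reasoning

excess-suc-double : ∀ m → excess (suc (2 *ℕ m)) ≡ ½ * excess m + 1ℚ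
excess-suc-double m = begin
  3ℚ * V (suc (2 *ℕ m)) - 2ℚ * fromℕ (suc (2 *ℕ m))
    ≡⟨ cong₂ (λ v x → 3ℚ * v - 2ℚ * x) (V-suc-double m) (fromℕ-suc (2 *ℕ m)) ⟩
  3ℚ * (V (2 *ℕ m) + 1ℚ) - 2ℚ * (1ℚ + fromℕ (2 *ℕ m))
    ≡⟨ solve 2 (λ v x → con 3ℚ :* (v :+ con 1ℚ) :- con 2ℚ :* (con 1ℚ :+ x)
                     := con 3ℚ :* v :- con 2ℚ :* x :+ con 1ℚ)
         refl (V (2 *ℕ m)) (fromℕ (2 *ℕ m)) ⟩
  excess (2 *ℕ m) + 1ℚ
    ≡⟨ cong (_+ 1ℚ) (excess-double m) ⟩
  ½ * excess m + 1ℚ ∎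
  where open ≡-Reasoning

Within[0,2] : ℚ → Set
Within[0,2] e = 0ℚ ≤ e × 0ℚ ≤ 2ℚ - e

½*-within : ∀ {e} → Within[0,2] e → Within[0,2] (½ * e)
½*-within {e} (0≤e , 0≤2-e) =
  *-nonNeg (nonNegative⁻¹ ½) 0≤e ,
  subst (0ℚ ≤_) (solve 1 (λ e → con ½ :* (con 2ℚ :- e) :+ con 1ℚ := con 2ℚ :- con ½ :* e) refl e)
    (ℚ.+-mono-≤ (*-nonNeg (nonNegative⁻¹ ½) 0≤2-e) (nonNegative⁻¹ 1ℚ))

½*+1-within : ∀ {e} → Within[0,2] e → Within[0,2] (½ * e + 1ℚ)
½*+1-within {e} (0≤e , 0≤2-e) =
  ℚ.+-mono-≤ (*-nonNeg (nonNegative⁻¹ ½) 0≤e) (nonNegative⁻¹ 1ℚ) ,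
  subst (0ℚ ≤_) (solve 1 (λ e → con ½ :* (con 2ℚ :- e) := con 2ℚ :- (con ½ :* e :+ con 1ℚ)) refl e)
    (*-nonNeg (nonNegative⁻¹ ½) 0≤2-e)

excess-within[0,2] : ∀ n .{{_ : NonZero n}} → Within[0,2] (excess n)
excess-within[0,2] = positive-binary-induction (Within[0,2] ∘ excess)
  (nonNegative⁻¹ 1ℚ , nonNegative⁻¹ 1ℚ)
  (λ m w → subst Within[0,2] (sym (excess-double m)) (½*-within w))
  (λ m w → subst Within[0,2] (sym (excess-suc-double m)) (½*+1-within w))

lowerDefect : ℕ → ℚ
lowerDefect n = fromℕ n * excess n - 1ℚ

upperDefect : ℕ → ℚ
upperDefect n = 2ℚ * fromℕ n - (1ℚ + fromℕ n) * excess n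

lowerDefect-double : ∀ m → lowerDefect (2 *ℕ m) ≡ lowerDefect m
lowerDefect-double m = begin
  fromℕ (2 *ℕ m) * excess (2 *ℕ m) - 1ℚ
    ≡⟨ cong₂ (λ x e → x * e - 1ℚ) (fromℕ-double m) (excess-double m) ⟩
  2ℚ * fromℕ m * (½ * excess m) - 1ℚ
    ≡⟨ solve 2 (λ x e → con 2ℚ :* x :* (con ½ :* e) :- con 1ℚ := x :* e :- con 1ℚ)
         refl (fromℕ m) (excess m) ⟩
  lowerDefect m ∎
  where open ≡-Reasoning

upperDefect-suc-double : ∀ m → upperDefect (suc (2 *ℕ m)) ≡ upperDefect m
upperDefect-suc-double m = begin
  2ℚ * fromℕ (suc (2 *ℕ m)) - (1ℚ + fromℕ (suc (2 *ℕ m))) * excess (suc (2 *ℕ m))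
    ≡⟨ cong₂ (λ y e → 2ℚ * y - (1ℚ + y) * e) (fromℕ-suc-double m) (excess-suc-double m) ⟩
  2ℚ * (1ℚ + 2ℚ * fromℕ m) - (1ℚ + (1ℚ + 2ℚ * fromℕ m)) * (½ * excess m + 1ℚ)
    ≡⟨ solve 2 (λ x e → con 2ℚ :* (con 1ℚ :+ con 2ℚ :* x)
                       :- (con 1ℚ :+ (con 1ℚ :+ con 2ℚ :* x)) :* (con ½ :* e :+ con 1ℚ)
                     := con 2ℚ :* x :- (con 1ℚ :+ x) :* e) refl (fromℕ m) (excess m) ⟩
  upperDefect m ∎
  where open ≡-Reasoning

lowerDefect-suc-double-pos : ∀ m .{{_ : NonZero m}} → 0ℚ < lowerDefect (suc (2 *ℕ m))
lowerDefect-suc-double-pos m = subst (0ℚ <_) (sym decomposition)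
  (ℚ.+-mono-≤-< (*-nonNeg (fromℕ-nonNeg _) (proj₁ (½*-within (excess-within[0,2] m))))
                (fromℕ-pos (2 *ℕ m) {{ℕ.m*n≢0 2 m}}))
  where
  open ≡-Reasoning
  decomposition : lowerDefect (suc (2 *ℕ m))
                ≡ fromℕ (suc (2 *ℕ m)) * (½ * excess m) + fromℕ (2 *ℕ m)
  decomposition = begin
    fromℕ (suc (2 *ℕ m)) * excess (suc (2 *ℕ m)) - 1ℚ
      ≡⟨ cong₂ (λ y e → y * e - 1ℚ) (fromℕ-suc (2 *ℕ m)) (excess-suc-double m) ⟩
    (1ℚ + fromℕ (2 *ℕ m)) * (½ * excess m + 1ℚ) - 1ℚ
      ≡⟨ solve 2 (λ z e → (con 1ℚ :+ z) :* (con ½ :* e :+ con 1ℚ) :- con 1ℚ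
                       := (con 1ℚ :+ z) :* (con ½ :* e) :+ z)
           refl (fromℕ (2 *ℕ m)) (excess m) ⟩
    (1ℚ + fromℕ (2 *ℕ m)) * (½ * excess m) + fromℕ (2 *ℕ m)
      ≡⟨ cong (λ y → y * (½ * excess m) + fromℕ (2 *ℕ m)) (sym (fromℕ-suc (2 *ℕ m))) ⟩
    fromℕ (suc (2 *ℕ m)) * (½ * excess m) + fromℕ (2 *ℕ m) ∎

upperDefect-double-pos : ∀ m .{{_ : NonZero m}} → 0ℚ < upperDefect (2 *ℕ m)
upperDefect-double-pos m@(suc k) = subst (0ℚ <_) (sym decomposition)
  (ℚ.+-mono-≤-<
    (*-nonNeg (ℚ.+-mono-≤ (nonNegative⁻¹ ½) (ℚ.+-mono-≤ (nonNegative⁻¹ 1ℚ) (fromℕ-nonNeg k)))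
              (proj₂ (excess-within[0,2] m)))
    (subst (0ℚ <_) (fromℕ-suc-double k) (fromℕ-pos (suc (2 *ℕ k)))))
  where
  open ≡-Reasoning
  decomposition : upperDefect (2 *ℕ m)
                ≡ (½ + (1ℚ + fromℕ k)) * (2ℚ - excess m) + (1ℚ + 2ℚ * fromℕ k)
  decomposition = begin
    2ℚ * fromℕ (2 *ℕ m) - (1ℚ + fromℕ (2 *ℕ m)) * excess (2 *ℕ m)
      ≡⟨ cong₂ (λ z e → 2ℚ * z - (1ℚ + z) * e)
           (trans (fromℕ-double m) (cong (2ℚ *_) (fromℕ-suc k))) (excess-double m) ⟩
    2ℚ * (2ℚ * (1ℚ + fromℕ k)) - (1ℚ + 2ℚ * (1ℚ + fromℕ k)) * (½ * excess m)
      ≡⟨ solve 2 (λ w e → con 2ℚ :* (con 2ℚ :* (con 1ℚ :+ w))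
                         :- (con 1ℚ :+ con 2ℚ :* (con 1ℚ :+ w)) :* (con ½ :* e)
                       := (con ½ :+ (con 1ℚ :+ w)) :* (con 2ℚ :- e) :+ (con 1ℚ :+ con 2ℚ :* w))
           refl (fromℕ k) (excess m) ⟩
    (½ + (1ℚ + fromℕ k)) * (2ℚ - excess m) + (1ℚ + 2ℚ * fromℕ k) ∎

suc-double-[2^k∸1] : ∀ k → suc (2 *ℕ (2 ^ k ∸ 1)) ≡ 2 ^ suc k ∸ 1
suc-double-[2^k∸1] k = begin
  suc (2 *ℕ (2 ^ k ∸ 1))     ≡⟨ cong suc (ℕ.*-distribˡ-∸ 2 (2 ^ k) 1) ⟩
  suc (2 *ℕ 2 ^ k ∸ 2)       ≡⟨ sym (ℕ.+-∸-assoc 1 (ℕ.*-monoʳ-≤ 2 (ℕ.m^n>0 2 k))) ⟩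
  2 ^ suc k ∸ 1              ∎
  where open ≡-Reasoning

lowerDefect-2^ : ∀ k → lowerDefect (2 ^ k) ≡ 0ℚ
lowerDefect-2^ zero = refl
lowerDefect-2^ (suc k) = trans (lowerDefect-double (2 ^ k)) (lowerDefect-2^ k)

upperDefect-2^∸1 : ∀ k → upperDefect (2 ^ k ∸ 1) ≡ 0ℚ
upperDefect-2^∸1 zero = refl
upperDefect-2^∸1 (suc k) = begin
  upperDefect (2 ^ suc k ∸ 1)            ≡⟨ cong upperDefect (sym (suc-double-[2^k∸1] k)) ⟩
  upperDefect (suc (2 *ℕ (2 ^ k ∸ 1)))   ≡⟨ upperDefect-suc-double (2 ^ k ∸ 1) ⟩
  upperDefect (2 ^ k ∸ 1)                ≡⟨ upperDefect-2^∸1 k ⟩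
  0ℚ                                     ∎
  where open ≡-Reasoning

lowerDefect-dichotomy : ∀ n .{{_ : NonZero n}} → (∃[ k ] n ≡ 2 ^ k) ⊎ 0ℚ < lowerDefect n
lowerDefect-dichotomy = positive-binary-induction _ (inj₁ (0 , refl))
  (λ m → Sum.map (λ (k , m≡2^k) → suc k , cong (2 *ℕ_) m≡2^k)
                 (subst (0ℚ <_) (sym (lowerDefect-double m))))
  (λ m _ → inj₂ (lowerDefect-suc-double-pos m))

upperDefect-dichotomy : ∀ n .{{_ : NonZero n}} →
                        (∃[ k ] n ≡ 2 ^ suc k ∸ 1) ⊎ 0ℚ < upperDefect n
upperDefect-dichotomy = positive-binary-induction _ (inj₁ (0 , refl))
  (λ m _ → inj₂ (upperDefect-double-pos m))
  (λ m → Sum.map (λ (k , m≡2^k∸1) →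
                   suc k , trans (cong (suc ∘ (2 *ℕ_)) m≡2^k∸1) (suc-double-[2^k∸1] (suc k)))
                 (subst (0ℚ <_) (sym (upperDefect-suc-double m))))

*-cancelˡ-≡-pos : ∀ c .{{_ : Positive c}} {x y} → c * x ≡ c * y → x ≡ y
*-cancelˡ-≡-pos c cx≡cy = ℚ.≤-antisym (ℚ.*-cancelˡ-≤-pos c (ℚ.≤-reflexive cx≡cy))
                                     (ℚ.*-cancelˡ-≤-pos c (ℚ.≤-reflexive (sym cx≡cy)))

scaled-gap : ∀ c .{{_ : Positive c}} {x y d} → c * y ≡ c * x + d →
             (d ≡ 0ℚ → x ≡ y) × (0ℚ < d → x < y)
scaled-gap c {x} {y} {d} cy≡cx+d =
  (λ d≡0 → *-cancelˡ-≡-pos c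
     (sym (trans cy≡cx+d (trans (cong (λ e → c * x + e) d≡0) (ℚ.+-identityʳ (c * x)))))) ,
  (λ 0<d → ℚ.*-cancelˡ-<-nonNeg c {{ℚ.pos⇒nonNeg c}}
             (subst₂ _<_ (ℚ.+-identityʳ (c * x)) (sym cy≡cx+d) (ℚ.+-monoʳ-< (c * x) 0<d)))

bound-with-equality : ∀ {P : Set} {x y} → (P → x ≡ y) → P ⊎ x < y → x ≤ y × (x ≡ y ⇔ P)
bound-with-equality equal (inj₁ p) = ℚ.≤-reflexive (equal p) , mk⇔ (λ _ → p) equal
bound-with-equality equal (inj₂ x<y) =
  ℚ.<⇒≤ x<y , mk⇔ (λ x≡y → contradiction x≡y (ℚ.<⇒≢ x<y)) equal

V-lowerBound-gap : ∀ n .{{_ : NonZero n}} →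
                   fromℕ (3 *ℕ n) * V n ≡ fromℕ (3 *ℕ n) * lowerBound n + lowerDefect n
V-lowerBound-gap n = begin
  fromℕ (3 *ℕ n) * V n
    ≡⟨ cong (_* V n) (fromℕ-* 3 n) ⟩
  3ℚ * x * V n
    ≡⟨ solve 2 (λ x v → con 3ℚ :* x :* v
                     := con 2ℚ :* x :* x :+ con 1ℚ :+ (x :* (con 3ℚ :* v :- con 2ℚ :* x) :- con 1ℚ))
         refl x (V n) ⟩
  2ℚ * x * x + 1ℚ + lowerDefect n
    ≡⟨ cong (_+ lowerDefect n) (sym numerator) ⟩
  fromℕ (3 *ℕ n) * lowerBound n + lowerDefect n ∎
  where
  open ≡-Reasoning
  x : ℚ
  x = fromℕ n
  numerator : fromℕ (3 *ℕ n) * lowerBound n ≡ 2ℚ * x * x + 1ℚ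
  numerator = begin
    fromℕ (3 *ℕ n) * lowerBound n
      ≡⟨ fromℕ-*-/ (2 *ℕ n *ℕ n +ℕ 1) (3 *ℕ n) {{ℕ.m*n≢0 3 n}} ⟩
    fromℕ (2 *ℕ n *ℕ n +ℕ 1)
      ≡⟨ fromℕ-+ (2 *ℕ n *ℕ n) 1 ⟩
    fromℕ (2 *ℕ n *ℕ n) + 1ℚ
      ≡⟨ cong (_+ 1ℚ) (trans (fromℕ-* (2 *ℕ n) n) (cong (_* x) (fromℕ-double n))) ⟩
    2ℚ * x * x + 1ℚ ∎

upperBound-V-gap : ∀ n →
                   fromℕ (3 *ℕ suc n) * upperBound n ≡ fromℕ (3 *ℕ suc n) * V n + upperDefect n
upperBound-V-gap n = begin
  fromℕ (3 *ℕ suc n) * upperBound n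
    ≡⟨ fromℕ-*-/ (2 *ℕ n *ℕ (n +ℕ 2)) (3 *ℕ suc n) ⟩
  fromℕ (2 *ℕ n *ℕ (n +ℕ 2))
    ≡⟨ trans (fromℕ-* (2 *ℕ n) (n +ℕ 2)) (cong₂ _*_ (fromℕ-double n) (fromℕ-+ n 2)) ⟩
  2ℚ * x * (x + 2ℚ)
    ≡⟨ solve 2 (λ x v → con 2ℚ :* x :* (x :+ con 2ℚ)
                     := con 3ℚ :* (con 1ℚ :+ x) :* v
                        :+ (con 2ℚ :* x :- (con 1ℚ :+ x) :* (con 3ℚ :* v :- con 2ℚ :* x)))
         refl x (V n) ⟩
  3ℚ * (1ℚ + x) * V n + upperDefect n
    ≡⟨ cong (λ c → c * V n + upperDefect n)
         (sym (trans (fromℕ-* 3 (suc n)) (cong (3ℚ *_) (fromℕ-suc n)))) ⟩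
  fromℕ (3 *ℕ suc n) * V n + upperDefect n ∎
  where
  open ≡-Reasoning
  x : ℚ
  x = fromℕ n

lowerBound-≤-V : ∀ n .{{_ : NonZero n}} →
                 lowerBound n ≤ V n × (lowerBound n ≡ V n ⇔ (∃[ m ] n ≡ 2 ^ m))
lowerBound-≤-V n = bound-with-equality
  (λ (m , n≡2^m) →
     proj₁ gap (subst (λ k → lowerDefect k ≡ 0ℚ) (sym n≡2^m) (lowerDefect-2^ m)))
  (Sum.map₂ (proj₂ gap) (lowerDefect-dichotomy n))
  where
  gap : (lowerDefect n ≡ 0ℚ → lowerBound n ≡ V n) × (0ℚ < lowerDefect n → lowerBound n < V n)
  gap = scaled-gap (fromℕ (3 *ℕ n)) {{positive (fromℕ-pos (3 *ℕ n) {{ℕ.m*n≢0 3 n}})}}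
          (V-lowerBound-gap n)

V-≤-upperBound : ∀ n .{{_ : NonZero n}} →
                 V n ≤ upperBound n × (V n ≡ upperBound n ⇔ (∃[ m ] n ≡ 2 ^ suc m ∸ 1))
V-≤-upperBound n = bound-with-equality
  (λ (m , n≡2^m+1∸1) →
     proj₁ gap (subst (λ k → upperDefect k ≡ 0ℚ) (sym n≡2^m+1∸1) (upperDefect-2^∸1 (suc m))))
  (Sum.map₂ (proj₂ gap) (upperDefect-dichotomy n))
  where
  gap : (upperDefect n ≡ 0ℚ → V n ≡ upperBound n) × (0ℚ < upperDefect n → V n < upperBound n)
  gap = scaled-gap (fromℕ (3 *ℕ suc n)) (upperBound-V-gap n)

theorem5 : (n : ℕ) → .{{_ : NonZero n}} →
    (lowerBound n ≤ V n)
    × (V n ≤ upperBound n)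
    × ((lowerBound n ≡ V n) ⇔ (∃[ m ] n ≡ 2 ^ m))
    × ((V n ≡ upperBound n) ⇔ (∃[ m ] n ≡ 2 ^ suc m ∸ 1))
theorem5 n =
  let lower , lower⇔ = lowerBound-≤-V n
      upper , upper⇔ = V-≤-upperBound n
  in lower , upper , lower⇔ , upper⇔
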